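{- Let $\Gamma=(S,R)$ be the line graph of a simple connected graph $G$ of order $n$. Then $\theta(V)$ has dimension $n-1$ if $n$ is odd and dimension $n-2$ if $n$ is even.
   Context: The line graph of $G$ has the edges of $G$ as vertices, with two of them adjacent iff they share an endpoint. Let $V$ be the $\mathbb{F}_2$-vector space with basis $\{\alpha_s\mid s\in S\}$ and let $V^\ast$ be its dual. Let $B$ be the bilinear form on $V$ with $B(\alpha_s,\alpha_t)=1$ if $st\in R$ and $0$ otherwise. Define $\theta:V\to V^\ast$ by $\theta(\alpha)(\beta)=B(\alpha,\beta)$. -}

module Defs where

open import Data.Nat using (ℕ; zero; suc)
open import Data.Fin using (Fin; zero; suc)
open import Data.Fin.Properties using (_≟_)
open import Data.Bool using (Bool; true; false; _∧_; _∨_; not; _xor_)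
open import Data.Product using (Σ; ∃; _×_; _,_; proj₁; proj₂)
open import Data.Sum using (_⊎_)
open import Relation.Nullary using (¬_)
open import Relation.Nullary.Decidable using (⌊_⌋)
open import Relation.Binary.PropositionalEquality using (_≡_; _≢_)
open import Relation.Binary.Construct.Closure.ReflexiveTransitive using (Star)

record SimpleGraph (n m : ℕ) : Set where
  field
    ends      : Fin m → Fin n × Fin n
    loopless  : ∀ e → proj₁ (ends e) ≢ proj₂ (ends e)
    noMulti   : ∀ e f → (proj₁ (ends e) ≡ proj₁ (ends f) × proj₂ (ends e) ≡ proj₂ (ends f))
                      ⊎ (proj₁ (ends e) ≡ proj₂ (ends f) × proj₂ (ends e) ≡ proj₁ (ends f))
                      → e ≡ f

open SimpleGraph public

Adj : ∀ {n m} → SimpleGraph n m → Fin n → Fin n → Set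
Adj G u v = ∃ λ e → (proj₁ (ends G e) ≡ u × proj₂ (ends G e) ≡ v)
                  ⊎ (proj₁ (ends G e) ≡ v × proj₂ (ends G e) ≡ u)

Connected : ∀ {n m} → SimpleGraph n m → Set
Connected G = ∀ u v → Star (Adj G) u v

-- Line graph Γ = (S , R): S = edges of G (= Fin m), and R(s,t) (as a
-- Boolean) holds iff s ≠ t and s, t share an endpoint.

_==_ : ∀ {n} → Fin n → Fin n → Bool
a == b = ⌊ a ≟ b ⌋

lineAdj : ∀ {n m} → SimpleGraph n m → Fin m → Fin m → Bool
lineAdj G s t =
  not (s == t) ∧
  ( (proj₁ (ends G s) == proj₁ (ends G t)) ∨ (proj₁ (ends G s) == proj₂ (ends G t))
  ∨ (proj₂ (ends G s) == proj₁ (ends G t)) ∨ (proj₂ (ends G s) == proj₂ (ends G t)))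

⨁ : ∀ {k} → (Fin k → Bool) → Bool
⨁ {zero}  f = false
⨁ {suc k} f = f zero xor ⨁ (λ i → f (suc i))

-- V = F₂-span of {α_s | s ∈ S}; a vector is its coordinate function S → F₂
V : ℕ → Set
V m = Fin m → Bool

B : ∀ {n m} → SimpleGraph n m → V m → V m → Bool
B G α β = ⨁ (λ s → ⨁ (λ t → α s ∧ β t ∧ lineAdj G s t))

-- θ : V → V*, θ(α)(β) = B(α, β); elements of V* are (linear) maps V → F₂
θ : ∀ {n m} → SimpleGraph n m → V m → (V m → Bool)
θ G α β = B G α β

Imθ : ∀ {n m} → SimpleGraph n m → (V m → Bool) → Set
Imθ {m = m} G f = ∃ λ (α : V m) → ∀ β → θ G α β ≡ f β

lincomb : ∀ {d} {X : Set} → (Fin d → Bool) → (Fin d → X → Bool) → X → Bool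
lincomb c b x = ⨁ (λ i → c i ∧ b i x)

HasDim : {X : Set} → ((X → Bool) → Set) → ℕ → Set
HasDim {X} W d =
  Σ (Fin d → X → Bool) λ b →
      (∀ i → W (b i))
    × (∀ c → (∀ x → lincomb c b x ≡ false) → ∀ i → c i ≡ false)
    × (∀ f → W f → ∃ λ c → ∀ x → lincomb c b x ≡ f x)

module Submission where

-- Over F₂ the form factors through the vertex–edge incidence map ∂ : V → F₂ⁿ: two distinct
-- edges of a simple graph share exactly one endpoint or none, so B(α, β) = ⟨∂α, ∂β⟩ and
-- θ = ∂ᵗ ∘ ∂.  For connected G the image of ∂ consists of the even-weight vectors
-- (dimension n − 1), while a vector orthogonal to every ∂α_s is constant along edges, so the
-- kernel of ∂ᵗ is spanned by the all-ones vector 𝟙.  Hence θ(V) ≅ im ∂ / (im ∂ ∩ ⟨𝟙⟩), and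
-- 𝟙 ∈ im ∂ exactly when n is even.

open import Defs
open import Algebra.Bundles using (CommutativeRing)
open import Data.Bool using (Bool; true; false; _∧_; _∨_; not; _xor_)
open import Data.Bool.Properties
  using ( xor-∧-commutativeRing; xor-assoc; xor-comm; xor-same; xor-identityʳ
        ; ∧-comm; ∧-assoc; ∧-zeroʳ; ∧-identityʳ; ∧-distribʳ-xor)
open import Data.Empty using (⊥-elim)
open import Data.Fin using (Fin; zero; suc)
open import Data.Fin.Properties using (_≟_)
open import Data.Nat using (zero; suc; _∸_; _%_)
open import Data.Nat.DivMod using ([m+n]%n≡m%n)
open import Data.Nat.Properties using (+-comm)
open import Data.Product using (∃; _×_; _,_; proj₁; proj₂)
open import Data.Sum using (inj₁; inj₂)
open import Function using (_∘_; flip)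
open import Relation.Binary.Construct.Closure.ReflexiveTransitive using (fold)
open import Relation.Binary.PropositionalEquality
open import Relation.Nullary using (¬_; Dec; yes; no)
open import Relation.Nullary.Decidable using (⌊_⌋; isYes≗does; dec-true; dec-false; ⌊⌋-map′)

open CommutativeRing xor-∧-commutativeRing using (semiring; +-group)
open import Algebra.Properties.Semiring.Sum semiring
  using (sum; sum-cong-≗; sum-replicate-zero; ∑-distrib-+; ∑-comm; *-distribˡ-sum; *-distribʳ-sum)
open import Algebra.Properties.Group +-group using (x∙y⁻¹≈ε⇒x≈y)

open ≡-Reasoning

xor≡false⇒≡ : ∀ x y → x xor y ≡ false → x ≡ y
xor≡false⇒≡ = x∙y⁻¹≈ε⇒x≈y

xor-cancel-middle : ∀ x y z → (x xor y) xor (y xor z) ≡ x xor z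
xor-cancel-middle x y z = begin
  (x xor y) xor (y xor z) ≡⟨ xor-assoc x y (y xor z) ⟩
  x xor (y xor (y xor z)) ≡⟨ cong (x xor_) (sym (xor-assoc y y z)) ⟩
  x xor ((y xor y) xor z) ≡⟨ cong (λ w → x xor (w xor z)) (xor-same y) ⟩
  x xor z                 ∎

%2-step : ∀ k → suc (suc k) % 2 ≡ k % 2
%2-step k = trans (cong (_% 2) (+-comm 2 k)) ([m+n]%n≡m%n k 2)

odd⇒pred-even : ∀ k → suc k % 2 ≡ 1 → k % 2 ≡ 0
odd⇒pred-even zero          _ = refl
odd⇒pred-even (suc zero)    ()
odd⇒pred-even (suc (suc k)) h = odd⇒pred-even k (trans (sym (%2-step (suc k))) h)

⨁≡sum : ∀ {k} (f : V k) → ⨁ f ≡ sum f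
⨁≡sum {zero}  f = refl
⨁≡sum {suc k} f = cong (f zero xor_) (⨁≡sum (f ∘ suc))

⨁-cong : ∀ {k} {f g : V k} → f ≗ g → ⨁ f ≡ ⨁ g
⨁-cong {f = f} {g} f≗g = trans (⨁≡sum f) (trans (sum-cong-≗ f≗g) (sym (⨁≡sum g)))

⨁-zero : ∀ k → ⨁ {k} (λ _ → false) ≡ false
⨁-zero k = trans (⨁≡sum {k} (λ _ → false)) (sum-replicate-zero k)

⨁-distrib-xor : ∀ {k} (f g : V k) → ⨁ (λ i → f i xor g i) ≡ ⨁ f xor ⨁ g
⨁-distrib-xor f g = begin
  ⨁ (λ i → f i xor g i) ≡⟨ ⨁≡sum (λ i → f i xor g i) ⟩
  sum (λ i → f i xor g i) ≡⟨ ∑-distrib-+ f g ⟩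
  sum f xor sum g       ≡⟨ sym (cong₂ _xor_ (⨁≡sum f) (⨁≡sum g)) ⟩
  ⨁ f xor ⨁ g           ∎

⨁-distribˡ-∧ : ∀ {k} x (f : V k) → ⨁ (λ i → x ∧ f i) ≡ x ∧ ⨁ f
⨁-distribˡ-∧ x f =
  trans (⨁≡sum (λ i → x ∧ f i)) (trans (sym (*-distribˡ-sum x f)) (cong (x ∧_) (sym (⨁≡sum f))))

⨁-distribʳ-∧ : ∀ {k} x (f : V k) → ⨁ (λ i → f i ∧ x) ≡ ⨁ f ∧ x
⨁-distribʳ-∧ x f =
  trans (⨁≡sum (λ i → f i ∧ x)) (trans (sym (*-distribʳ-sum x f)) (cong (_∧ x) (sym (⨁≡sum f))))

⨁-comm : ∀ {k l} (f : Fin k → Fin l → Bool) →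
         ⨁ (λ i → ⨁ (λ j → f i j)) ≡ ⨁ (λ j → ⨁ (λ i → f i j))
⨁-comm f = trans (⨁⨁≡∑∑ f) (trans (∑-comm f) (sym (⨁⨁≡∑∑ (flip f))))
  where
    ⨁⨁≡∑∑ : ∀ {k l} (g : Fin k → Fin l → Bool) → ⨁ (λ i → ⨁ (g i)) ≡ sum (λ i → sum (g i))
    ⨁⨁≡∑∑ g = trans (⨁-cong (λ i → ⨁≡sum (g i))) (⨁≡sum (λ i → sum (g i)))

⨁-const-even : ∀ k → k % 2 ≡ 0 → ∀ x → ⨁ {k} (λ _ → x) ≡ false
⨁-const-even zero          _ x = refl
⨁-const-even (suc zero)    () x
⨁-const-even (suc (suc k)) h x = begin
  x xor (x xor ⨁ {k} (λ _ → x)) ≡⟨ sym (xor-assoc x x _) ⟩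
  (x xor x) xor ⨁ {k} (λ _ → x) ≡⟨ cong (_xor ⨁ {k} (λ _ → x)) (xor-same x) ⟩
  ⨁ {k} (λ _ → x)               ≡⟨ ⨁-const-even k (trans (sym (%2-step k)) h) x ⟩
  false                         ∎

==-true : ∀ {k} {a b : Fin k} → a ≡ b → (a == b) ≡ true
==-true {a = a} {b} a≡b = trans (isYes≗does (a ≟ b)) (dec-true (a ≟ b) a≡b)

==-false : ∀ {k} {a b : Fin k} → a ≢ b → (a == b) ≡ false
==-false {a = a} {b} a≢b = trans (isYes≗does (a ≟ b)) (dec-false (a ≟ b) a≢b)

==-suc : ∀ {k} (a b : Fin k) → (suc a == suc b) ≡ (a == b)
==-suc a b = ⌊⌋-map′ (cong suc) _ (a ≟ b)

==-sym : ∀ {k} (a b : Fin k) → (a == b) ≡ (b == a)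
==-sym a b with a ≟ b
... | yes a≡b = sym (==-true (sym a≡b))
... | no  a≢b = sym (==-false (a≢b ∘ sym))

e : ∀ {k} → Fin k → V k
e a i = i == a

_⊕_ : ∀ {k} → V k → V k → V k
(x ⊕ y) i = x i xor y i

⨁-δˡ : ∀ {k} (a : Fin k) (f : V k) → ⨁ (λ i → e a i ∧ f i) ≡ f a
⨁-δˡ {suc k} zero    f = trans (cong (f zero xor_) (⨁-zero k)) (xor-identityʳ (f zero))
⨁-δˡ {suc k} (suc a) f =
  trans (⨁-cong (λ i → cong (_∧ f (suc i)) (==-suc i a))) (⨁-δˡ a (f ∘ suc))

⨁-δʳ : ∀ {k} (a : Fin k) (f : V k) → ⨁ (λ i → f i ∧ e a i) ≡ f a
⨁-δʳ a f = trans (⨁-cong (λ i → ∧-comm (f i) (e a i))) (⨁-δˡ a f)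

⨁-e : ∀ {k} (a : Fin k) → ⨁ (e a) ≡ true
⨁-e a = trans (⨁-cong (λ i → sym (∧-identityʳ (e a i)))) (⨁-δˡ a (λ _ → true))

lincomb-e : ∀ {d} {X : Set} (b : Fin d → X → Bool) t x → lincomb (e t) b x ≡ b t x
lincomb-e b t x = ⨁-δˡ t (λ i → b i x)

lincomb-⊕ : ∀ {d} {X : Set} (c c′ : V d) (b : Fin d → X → Bool) x →
            lincomb (c ⊕ c′) b x ≡ lincomb c b x xor lincomb c′ b x
lincomb-⊕ c c′ b x = trans (⨁-cong (λ i → ∧-distribʳ-xor (b i x) (c i) (c′ i)))
                           (⨁-distrib-xor (λ i → c i ∧ b i x) (λ i → c′ i ∧ b i x))

lincomb-basis : ∀ {k} (c : V k) j → lincomb c e j ≡ c j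
lincomb-basis c j = trans (⨁-cong (λ i → cong (c i ∧_) (==-sym j i))) (⨁-δʳ j c)

⟨_,_⟩ : ∀ {k} → V k → V k → Bool
⟨ x , y ⟩ = ⨁ (λ i → x i ∧ y i)

⟨⟩-comm : ∀ {k} (x y : V k) → ⟨ x , y ⟩ ≡ ⟨ y , x ⟩
⟨⟩-comm x y = ⨁-cong (λ i → ∧-comm (x i) (y i))

⟨⟩-congˡ : ∀ {k} {x x′ : V k} → x ≗ x′ → ∀ y → ⟨ x , y ⟩ ≡ ⟨ x′ , y ⟩
⟨⟩-congˡ x≗x′ y = ⨁-cong (λ i → cong (_∧ y i) (x≗x′ i))

⟨⟩-distribˡ-⊕ : ∀ {k} (x x′ y : V k) → ⟨ x ⊕ x′ , y ⟩ ≡ ⟨ x , y ⟩ xor ⟨ x′ , y ⟩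
⟨⟩-distribˡ-⊕ x x′ y = trans (⨁-cong (λ i → ∧-distribʳ-xor (y i) (x i) (x′ i)))
                              (⨁-distrib-xor (λ i → x i ∧ y i) (λ i → x′ i ∧ y i))

⟨⟩-lincombˡ : ∀ {d k} (c : V d) (y : Fin d → V k) z →
              ⟨ lincomb c y , z ⟩ ≡ ⨁ (λ i → c i ∧ ⟨ y i , z ⟩)
⟨⟩-lincombˡ c y z = begin
  ⨁ (λ u → ⨁ (λ i → c i ∧ y i u) ∧ z u)   ≡⟨ ⨁-cong (λ u → sym (⨁-distribʳ-∧ (z u) (λ i → c i ∧ y i u))) ⟩
  ⨁ (λ u → ⨁ (λ i → (c i ∧ y i u) ∧ z u)) ≡⟨ ⨁-cong (λ u → ⨁-cong (λ i → ∧-assoc (c i) (y i u) (z u))) ⟩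
  ⨁ (λ u → ⨁ (λ i → c i ∧ y i u ∧ z u))   ≡⟨ ⨁-comm (λ u i → c i ∧ y i u ∧ z u) ⟩
  ⨁ (λ i → ⨁ (λ u → c i ∧ y i u ∧ z u))   ≡⟨ ⨁-cong (λ i → ⨁-distribˡ-∧ (c i) (λ u → y i u ∧ z u)) ⟩
  ⨁ (λ i → c i ∧ ⟨ y i , z ⟩)             ∎

⟨⟩-lincombʳ : ∀ {d k} (c : V d) (y : Fin d → V k) z →
              ⟨ z , lincomb c y ⟩ ≡ ⨁ (λ i → c i ∧ ⟨ z , y i ⟩)
⟨⟩-lincombʳ c y z = begin
  ⟨ z , lincomb c y ⟩           ≡⟨ ⟨⟩-comm z (lincomb c y) ⟩
  ⟨ lincomb c y , z ⟩           ≡⟨ ⟨⟩-lincombˡ c y z ⟩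
  ⨁ (λ i → c i ∧ ⟨ y i , z ⟩) ≡⟨ ⨁-cong (λ i → cong (c i ∧_) (⟨⟩-comm (y i) z)) ⟩
  ⨁ (λ i → c i ∧ ⟨ z , y i ⟩) ∎

⟨lincomb,lincomb⟩ : ∀ {d k} (c c′ : V d) (b : Fin d → V k) →
  ⟨ lincomb c b , lincomb c′ b ⟩ ≡ ⨁ (λ s → ⨁ (λ t → c s ∧ c′ t ∧ ⟨ b s , b t ⟩))
⟨lincomb,lincomb⟩ c c′ b = begin
  ⟨ lincomb c b , lincomb c′ b ⟩
    ≡⟨ ⟨⟩-lincombˡ c b (lincomb c′ b) ⟩
  ⨁ (λ s → c s ∧ ⟨ b s , lincomb c′ b ⟩)
    ≡⟨ ⨁-cong (λ s → cong (c s ∧_) (⟨⟩-lincombʳ c′ b (b s))) ⟩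
  ⨁ (λ s → c s ∧ ⨁ (λ t → c′ t ∧ ⟨ b s , b t ⟩))
    ≡⟨ ⨁-cong (λ s → sym (⨁-distribˡ-∧ (c s) (λ t → c′ t ∧ ⟨ b s , b t ⟩))) ⟩
  ⨁ (λ s → ⨁ (λ t → c s ∧ c′ t ∧ ⟨ b s , b t ⟩))
    ∎

-- Two distinct 2-sets meet in at most one point, so at most one of the four tests holds.
distinct-pairs-xor≡∨ : ∀ {k} {a b c d : Fin k} → a ≢ b → c ≢ d →
  ¬ (a ≡ c × b ≡ d) → ¬ (a ≡ d × b ≡ c) →
  ((a == c) xor (a == d)) xor ((b == c) xor (b == d)) ≡ (a == c) ∨ (a == d) ∨ (b == c) ∨ (b == d)
distinct-pairs-xor≡∨ {a = a} {b} {c} {d} a≢b c≢d ¬ac∧bd ¬ad∧bc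
  with a ≟ c | a ≟ d | b ≟ c | b ≟ d
... | no _    | no _    | no _    | no _    = refl
... | no _    | no _    | no _    | yes _   = refl
... | no _    | no _    | yes _   | no _    = refl
... | no _    | yes _   | no _    | no _    = refl
... | yes _   | no _    | no _    | no _    = refl
... | yes a≡c | yes a≡d | _       | _       = ⊥-elim (c≢d (trans (sym a≡c) a≡d))
... | yes a≡c | _       | yes b≡c | _       = ⊥-elim (a≢b (trans a≡c (sym b≡c)))
... | yes a≡c | _       | _       | yes b≡d = ⊥-elim (¬ac∧bd (a≡c , b≡d))
... | _       | yes a≡d | yes b≡c | _       = ⊥-elim (¬ad∧bc (a≡d , b≡c))
... | _       | yes a≡d | _       | yes b≡d = ⊥-elim (a≢b (trans a≡d (sym b≡d)))
... | _       | _       | yes b≡c | yes b≡d = ⊥-elim (c≢d (trans (sym b≡c) b≡d))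

module _ {n m} (G : SimpleGraph n m) where

  end₁ end₂ : Fin m → Fin n
  end₁ t = proj₁ (ends G t)
  end₂ t = proj₂ (ends G t)

  incidence : Fin m → V n
  incidence t = e (end₁ t) ⊕ e (end₂ t)

  ∂ : V m → V n
  ∂ α = lincomb α incidence

  ∂ᵗ : V n → V m → Bool
  ∂ᵗ y β = ⟨ y , ∂ β ⟩

  incidence-overlap : ∀ s t → ⟨ incidence s , incidence t ⟩ ≡ lineAdj G s t
  incidence-overlap s t = begin
    ⟨ incidence s , incidence t ⟩                   ≡⟨ ⟨⟩-distribˡ-⊕ (e (end₁ s)) (e (end₂ s)) (incidence t) ⟩
    ⟨ e (end₁ s) , incidence t ⟩ xor ⟨ e (end₂ s) , incidence t ⟩
                                                    ≡⟨ cong₂ _xor_ (⨁-δˡ (end₁ s) (incidence t)) (⨁-δˡ (end₂ s) (incidence t)) ⟩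
    incidence t (end₁ s) xor incidence t (end₂ s)   ≡⟨ shared-endpoints (s ≟ t) ⟩
    lineAdj G s t                                   ∎
    where
      -- The right-hand side is lineAdj G s t with s ≟ t generalised, so that it can be split on.
      shared-endpoints : (s≟t : Dec (s ≡ t)) →
        incidence t (end₁ s) xor incidence t (end₂ s)
          ≡ not ⌊ s≟t ⌋ ∧ ((end₁ s == end₁ t) ∨ (end₁ s == end₂ t) ∨ (end₂ s == end₁ t) ∨ (end₂ s == end₂ t))
      shared-endpoints (yes refl)
        rewrite ==-true (refl {x = end₁ s}) | ==-true (refl {x = end₂ s})
              | ==-false (loopless G s) | ==-false (loopless G s ∘ sym) = refl
      shared-endpoints (no s≢t) = distinct-pairs-xor≡∨ (loopless G s) (loopless G t)
        (s≢t ∘ noMulti G s t ∘ inj₁) (s≢t ∘ noMulti G s t ∘ inj₂)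

  θ≡∂ᵗ∘∂ : ∀ α β → θ G α β ≡ ∂ᵗ (∂ α) β
  θ≡∂ᵗ∘∂ α β = sym (trans (⟨lincomb,lincomb⟩ α β incidence)
    (⨁-cong (λ s → ⨁-cong (λ t → cong (λ x → α s ∧ β t ∧ x) (incidence-overlap s t)))))

  ∂-e : ∀ t → ∂ (e t) ≗ incidence t
  ∂-e t = lincomb-e incidence t

  ∂ᵗ-lincomb : ∀ {d} (c : V d) (y : Fin d → V n) β → lincomb c (∂ᵗ ∘ y) β ≡ ∂ᵗ (lincomb c y) β
  ∂ᵗ-lincomb c y β = sym (⟨⟩-lincombˡ c y (∂ β))

  ∂ᵗ-e : ∀ y t → ∂ᵗ y (e t) ≡ y (end₁ t) xor y (end₂ t)
  ∂ᵗ-e y t = begin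
    ⟨ y , ∂ (e t) ⟩                               ≡⟨ ⟨⟩-comm y (∂ (e t)) ⟩
    ⟨ ∂ (e t) , y ⟩                               ≡⟨ ⟨⟩-congˡ (∂-e t) y ⟩
    ⟨ incidence t , y ⟩                           ≡⟨ ⟨⟩-distribˡ-⊕ (e (end₁ t)) (e (end₂ t)) y ⟩
    ⟨ e (end₁ t) , y ⟩ xor ⟨ e (end₂ t) , y ⟩     ≡⟨ cong₂ _xor_ (⨁-δˡ (end₁ t) y) (⨁-δˡ (end₂ t) y) ⟩
    y (end₁ t) xor y (end₂ t)                     ∎

  ⨁-∂≡false : ∀ α → ⨁ (∂ α) ≡ false
  ⨁-∂≡false α = begin -- ⨁ y is ⟨ 𝟙 , y ⟩ on the nose, since true ∧ x reduces to x
    ⟨ (λ _ → true) , lincomb α incidence ⟩        ≡⟨ ⟨⟩-lincombʳ α incidence (λ _ → true) ⟩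
    ⨁ (λ s → α s ∧ ⨁ (incidence s))              ≡⟨ ⨁-cong (λ s → cong (α s ∧_) (⨁-incidence s)) ⟩
    ⨁ (λ s → α s ∧ false)                         ≡⟨ ⨁-cong (λ s → ∧-zeroʳ (α s)) ⟩
    ⨁ {m} (λ _ → false)                           ≡⟨ ⨁-zero m ⟩
    false                                         ∎
    where
      ⨁-incidence : ∀ s → ⨁ (incidence s) ≡ false
      ⨁-incidence s = trans (⨁-distrib-xor (e (end₁ s)) (e (end₂ s)))
                            (cong₂ _xor_ (⨁-e (end₁ s)) (⨁-e (end₂ s)))

  ∂ᵗ-shift : ∀ y x β → ∂ᵗ (y ⊕ (λ _ → x)) β ≡ ∂ᵗ y β
  ∂ᵗ-shift y x β = begin
    ⟨ y ⊕ (λ _ → x) , ∂ β ⟩                 ≡⟨ ⟨⟩-distribˡ-⊕ y (λ _ → x) (∂ β) ⟩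
    ∂ᵗ y β xor ⨁ (λ u → x ∧ ∂ β u)          ≡⟨ cong (∂ᵗ y β xor_) (⨁-distribˡ-∧ x (∂ β)) ⟩
    ∂ᵗ y β xor (x ∧ ⨁ (∂ β))                ≡⟨ cong (λ w → ∂ᵗ y β xor (x ∧ w)) (⨁-∂≡false β) ⟩
    ∂ᵗ y β xor (x ∧ false)                  ≡⟨ cong (∂ᵗ y β xor_) (∧-zeroʳ x) ⟩
    ∂ᵗ y β xor false                        ≡⟨ xor-identityʳ (∂ᵗ y β) ⟩
    ∂ᵗ y β                                  ∎

  module _ (connected : Connected G) where

    ∂ᵗ-kernel-constant : ∀ y → (∀ β → ∂ᵗ y β ≡ false) → ∀ u v → y u ≡ y v
    ∂ᵗ-kernel-constant y ∂ᵗy≡0 u v =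
      fold (λ u v → y u ≡ y v) (λ adj → trans (adjacent adj)) refl (connected u v)
      where
        along-edge : ∀ t → y (end₁ t) ≡ y (end₂ t)
        along-edge t = xor≡false⇒≡ _ _ (trans (sym (∂ᵗ-e y t)) (∂ᵗy≡0 (e t)))
        adjacent : ∀ {u v} → Adj G u v → y u ≡ y v
        adjacent (t , inj₁ (refl , refl)) = along-edge t
        adjacent (t , inj₂ (refl , refl)) = sym (along-edge t)

    ∂-hits-pairs : ∀ u v → ∃ λ α → ∂ α ≗ e u ⊕ e v
    ∂-hits-pairs u v = fold Bounds extend empty-walk (connected u v)
      where
        Bounds : Fin n → Fin n → Set
        Bounds u v = ∃ λ α → ∂ α ≗ e u ⊕ e v
        edge : ∀ {u v} → Adj G u v → ∃ λ t → incidence t ≗ e u ⊕ e v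
        edge (t , inj₁ (refl , refl)) = t , λ x → refl
        edge (t , inj₂ (refl , refl)) = t , λ x → xor-comm (e (end₁ t) x) (e (end₂ t) x)
        empty-walk : ∀ {w} → Bounds w w
        empty-walk {w} = (λ _ → false) , λ x → trans (⨁-zero m) (sym (xor-same (e w x)))
        extend : ∀ {u j v} → Adj G u j → Bounds j v → Bounds u v
        extend {u} {j} {v} adj (α , ∂α≗) with edge adj
        ... | t , incidence≗ = e t ⊕ α , λ x → begin
          ∂ (e t ⊕ α) x                               ≡⟨ lincomb-⊕ (e t) α incidence x ⟩
          ∂ (e t) x xor ∂ α x                         ≡⟨ cong₂ _xor_ (trans (∂-e t x) (incidence≗ x)) (∂α≗ x) ⟩
          (e u x xor e j x) xor (e j x xor e v x)     ≡⟨ xor-cancel-middle (e u x) (e j x) (e v x) ⟩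
          e u x xor e v x                             ∎

    lincomb-∂ᵗ-kernel-constant : ∀ {d} (c : V d) (y : Fin d → V n) →
      (∀ β → lincomb c (∂ᵗ ∘ y) β ≡ false) → ∀ u v → lincomb c y u ≡ lincomb c y v
    lincomb-∂ᵗ-kernel-constant c y c·∂ᵗy≡0 =
      ∂ᵗ-kernel-constant (lincomb c y) (λ β → trans (sym (∂ᵗ-lincomb c y β)) (c·∂ᵗy≡0 β))

    pair∈Imθ : ∀ u v → Imθ G (∂ᵗ (e u ⊕ e v))
    pair∈Imθ u v with ∂-hits-pairs u v
    ... | α , ∂α≗ = α , λ β → trans (θ≡∂ᵗ∘∂ α β) (⟨⟩-congˡ ∂α≗ (∂ β))

Imθ-no-vertices : ∀ {m} (G : SimpleGraph 0 m) → HasDim (Imθ G) 0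
Imθ-no-vertices G =
  (λ ()) , (λ ()) , (λ _ _ ()) , λ f (α , θα≗f) → (λ ()) , λ β → trans (sym (θ≡∂ᵗ∘∂ G α β)) (θα≗f β)

-- A combination of the basis vectors lying in ker ∂ᵗ is constant, and a constant vector of
-- even weight on the odd number k + 1 of vertices vanishes.
Imθ-odd : ∀ {k m} (G : SimpleGraph (suc k) m) → Connected G → k % 2 ≡ 0 → HasDim (Imθ G) k
Imθ-odd {k} {m} G connected k-even =
  ∂ᵗ G ∘ y , pair∈Imθ G connected zero ∘ suc , independent , spanning
  where
    y : Fin k → V (suc k)
    y i = e zero ⊕ e (suc i)
    at-zero : ∀ c → lincomb c y zero ≡ ⨁ c
    at-zero c = ⨁-cong (λ i → ∧-identityʳ (c i))
    at-suc : ∀ c j → lincomb c y (suc j) ≡ c j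
    at-suc c j = trans (⨁-cong (λ i → cong (c i ∧_) (==-suc j i))) (lincomb-basis c j)
    independent : ∀ c → (∀ β → lincomb c (∂ᵗ G ∘ y) β ≡ false) → ∀ i → c i ≡ false
    independent c c·b≡0 i = begin
      c i                               ≡⟨ sym (at-suc c i) ⟩
      lincomb c y (suc i)               ≡⟨ constant (suc i) ⟩
      lincomb c y zero                  ≡⟨ at-zero c ⟩
      ⨁ c                               ≡⟨ ⨁-cong (λ j → trans (sym (at-suc c j)) (constant (suc j))) ⟩
      ⨁ {k} (λ _ → lincomb c y zero)    ≡⟨ ⨁-const-even k k-even (lincomb c y zero) ⟩
      false                             ∎
      where
        constant : ∀ u → lincomb c y u ≡ lincomb c y zero
        constant u = lincomb-∂ᵗ-kernel-constant G connected c y c·b≡0 u zero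
    spanning : ∀ f → Imθ G f → ∃ λ c → ∀ β → lincomb c (∂ᵗ G ∘ y) β ≡ f β
    spanning f (α , θα≗f) = c , λ β → begin
      lincomb c (∂ᵗ G ∘ y) β    ≡⟨ ∂ᵗ-lincomb G c y β ⟩
      ∂ᵗ G (lincomb c y) β      ≡⟨ ⟨⟩-congˡ coordinates (∂ G β) ⟩
      ∂ᵗ G (∂ G α) β            ≡⟨ sym (θ≡∂ᵗ∘∂ G α β) ⟩
      θ G α β                   ≡⟨ θα≗f β ⟩
      f β                       ∎
      where
        c : V k
        c i = ∂ G α (suc i)
        coordinates : lincomb c y ≗ ∂ G α
        coordinates zero    = trans (at-zero c) (sym (xor≡false⇒≡ (∂ G α zero) (⨁ c) (⨁-∂≡false G α)))
        coordinates (suc j) = at-suc c j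

-- Adding the constant ∂α(1), which ∂ᵗ does not see, clears coordinate 1 of ∂α; the remaining
-- even-weight vector is determined by its coordinates 2 … k + 1.
Imθ-even : ∀ {k m} (G : SimpleGraph (suc (suc k)) m) → Connected G → k % 2 ≡ 0 → HasDim (Imθ G) k
Imθ-even {k} {m} G connected k-even =
  ∂ᵗ G ∘ y , (λ i → pair∈Imθ G connected zero (suc (suc i))) , independent , spanning
  where
    y : Fin k → V (suc (suc k))
    y i = e zero ⊕ e (suc (suc i))
    at-zero : ∀ c → lincomb c y zero ≡ ⨁ c
    at-zero c = ⨁-cong (λ i → ∧-identityʳ (c i))
    at-one : ∀ c → lincomb c y (suc zero) ≡ false
    at-one c = trans (⨁-cong (λ i → ∧-zeroʳ (c i))) (⨁-zero k)
    at-suc-suc : ∀ c j → lincomb c y (suc (suc j)) ≡ c j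
    at-suc-suc c j = trans (⨁-cong (λ i → cong (c i ∧_) (trans (==-suc (suc j) (suc i)) (==-suc j i))))
                           (lincomb-basis c j)
    independent : ∀ c → (∀ β → lincomb c (∂ᵗ G ∘ y) β ≡ false) → ∀ i → c i ≡ false
    independent c c·b≡0 i = begin
      c i                           ≡⟨ sym (at-suc-suc c i) ⟩
      lincomb c y (suc (suc i))     ≡⟨ lincomb-∂ᵗ-kernel-constant G connected c y c·b≡0 (suc (suc i)) (suc zero) ⟩
      lincomb c y (suc zero)        ≡⟨ at-one c ⟩
      false                         ∎
    spanning : ∀ f → Imθ G f → ∃ λ c → ∀ β → lincomb c (∂ᵗ G ∘ y) β ≡ f β
    spanning f (α , θα≗f) = c , λ β → begin
      lincomb c (∂ᵗ G ∘ y) β    ≡⟨ ∂ᵗ-lincomb G c y β ⟩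
      ∂ᵗ G (lincomb c y) β      ≡⟨ ⟨⟩-congˡ coordinates (∂ G β) ⟩
      ∂ᵗ G y′ β                 ≡⟨ ∂ᵗ-shift G (∂ G α) x β ⟩
      ∂ᵗ G (∂ G α) β            ≡⟨ sym (θ≡∂ᵗ∘∂ G α β) ⟩
      θ G α β                   ≡⟨ θα≗f β ⟩
      f β                       ∎
      where
        x : Bool
        x = ∂ G α (suc zero)
        y′ : V (suc (suc k))
        y′ = ∂ G α ⊕ (λ _ → x)
        c : V k
        c i = y′ (suc (suc i))
        even-weight : y′ zero xor ⨁ c ≡ false
        even-weight = begin
          y′ zero xor ⨁ c                          ≡⟨ cong (λ w → y′ zero xor (w xor ⨁ c)) (sym (xor-same x)) ⟩
          ⨁ y′                                     ≡⟨ ⨁-distrib-xor (∂ G α) (λ _ → x) ⟩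
          ⨁ (∂ G α) xor ⨁ {suc (suc k)} (λ _ → x)  ≡⟨ cong₂ _xor_ (⨁-∂≡false G α)
                                                         (⨁-const-even (suc (suc k)) (trans (%2-step k) k-even) x) ⟩
          false                                    ∎
        coordinates : lincomb c y ≗ y′
        coordinates zero          = trans (at-zero c) (sym (xor≡false⇒≡ (y′ zero) (⨁ c) even-weight))
        coordinates (suc zero)    = trans (at-one c) (sym (xor-same x))
        coordinates (suc (suc j)) = at-suc-suc c j

lemma2p2 : ∀ {n m} (G : SimpleGraph n m) → Connected G →
           (n % 2 ≡ 1 → HasDim (Imθ G) (n ∸ 1))
           × (n % 2 ≡ 0 → HasDim (Imθ G) (n ∸ 2))
lemma2p2 {zero}        G connected = (λ ()) , λ _ → Imθ-no-vertices G
lemma2p2 {suc zero}    G connected = Imθ-odd G connected ∘ odd⇒pred-even 0 , λ ()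
lemma2p2 {suc (suc k)} G connected =
  Imθ-odd G connected ∘ odd⇒pred-even (suc k) , Imθ-even G connected ∘ trans (sym (%2-step k))
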